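{- Let $n \ge 2$ and let $C_n = \{a_0, a_1, \ldots, a_{n-1}\}$ be the chain with $a_0 < a_1 < \cdots < a_{n-1}$, with $0 = a_0$ and $1 = a_{n-1}$, lattice operations $\wedge = \min$ and $\vee = \max$. Suppose $\to$ is a binary operation on $C_n$ such that $\mathbf{C}_n = \langle C_n, \wedge, \vee, \to, 0, 1\rangle$ is a semi-Heyting algebra. Then the set $C_n \setminus \{a_0\} = \{a_1, \ldots, a_{n-1}\}$ is closed under $\to$, and $\mathbf{S}_{n-1} = \langle C_n \setminus\{a_0\}, \wedge, \vee, \to, a_1, 1\rangle$ (with the restricted operations) is a semi-Heyting algebra.
   Context: An algebra $\langle L, \vee, \wedge, \to, 0, 1\rangle$ is a semi-Heyting algebra if: (SH1) $\langle L, \vee, \wedge, 0, 1\rangle$ is a lattice with least element $0$ and greatest element $1$; (SH2) $x \wedge (x \to y) = x \wedge y$ for all $x,y$; (SH3) $x \wedge (y \to z) = x \wedge [(x \wedge y) \to (x \wedge z)]$ for all $x,y,z$; (SH4) $x \to x = 1$ for all $x$. -}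

module Defs where

open import Data.Nat using (ℕ; suc)
open import Data.Fin using (Fin; zero; suc; fromℕ; _≤?_)
open import Data.Product using (_×_)
open import Relation.Binary.PropositionalEquality using (_≡_)
open import Relation.Nullary using (yes; no)

record IsSemiHeyting {A : Set} (_∨_ _∧_ _⇒_ : A → A → A) (⊥ ⊤ : A) : Set where
  field
    ∨-comm   : ∀ x y → (x ∨ y) ≡ (y ∨ x)
    ∧-comm   : ∀ x y → (x ∧ y) ≡ (y ∧ x)
    ∨-assoc  : ∀ x y z → ((x ∨ y) ∨ z) ≡ (x ∨ (y ∨ z))
    ∧-assoc  : ∀ x y z → ((x ∧ y) ∧ z) ≡ (x ∧ (y ∧ z))
    ∨-absorbs-∧ : ∀ x y → (x ∨ (x ∧ y)) ≡ x
    ∧-absorbs-∨ : ∀ x y → (x ∧ (x ∨ y)) ≡ x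
    ⊥-least  : ∀ x → (⊥ ∧ x) ≡ ⊥
    ⊤-greatest : ∀ x → (x ∧ ⊤) ≡ x
    sh2 : ∀ x y → (x ∧ (x ⇒ y)) ≡ (x ∧ y)
    sh3 : ∀ x y z → (x ∧ (y ⇒ z)) ≡ (x ∧ ((x ∧ y) ⇒ (x ∧ z)))
    sh4 : ∀ x → (x ⇒ x) ≡ ⊤

-- The chain C_n on Fin n, a_i = i, ordered as in Fin.
minF : {n : ℕ} → Fin n → Fin n → Fin n
minF x y with x ≤? y
... | yes _ = x
... | no  _ = y

maxF : {n : ℕ} → Fin n → Fin n → Fin n
maxF x y with x ≤? y
... | yes _ = y
... | no  _ = x

topF : (k : ℕ) → Fin (suc k)
topF k = fromℕ k

-- By (SH2), x ∧ (x ⇒ y) = x ∧ y, so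
-- x ⇒ y = 0 forces x ∧ y = 0; in a chain the meet is one of its arguments,
-- hence x = 0 or y = 0.  Thus C ∖ {0} is closed under ⇒, and ⇒ restricts to
-- an operation ⇒' on Fin (1 + m) with suc (x ⇒' y) = suc x ⇒ suc y.
--
-- The semi-Heyting laws for the restriction are then inherited along the
-- embedding suc : Fin (1 + m) → Fin (2 + m): every axiom is an equation,
-- suc is injective and commutes with min, max, ⇒ and the top element, and
-- the new bottom a₁ is the least element of the image.
module Submission where

open import Defs
open import Data.Nat using (ℕ; suc)
open import Data.Fin using (Fin; zero; suc; _≤_; _≤?_)
open import Data.Fin.Properties using (suc-injective)
open import Data.Nat.Base using (s≤s; z≤n)
open import Data.Product using (Σ; _×_; _,_; proj₁; proj₂)
open import Data.Sum using (_⊎_; inj₁; inj₂)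
open import Function using (Injective)
open import Relation.Binary.PropositionalEquality
  using (_≡_; refl; sym; trans; cong; cong₂; module ≡-Reasoning)
open import Relation.Nullary using (¬_; yes; no; contradiction)

minF-selective : ∀ {n} (x y : Fin n) → minF x y ≡ x ⊎ minF x y ≡ y
minF-selective x y with x ≤? y
... | yes _ = inj₁ refl
... | no  _ = inj₂ refl

minF-≤ : ∀ {n} {x y : Fin n} → x ≤ y → minF x y ≡ x
minF-≤ {x = x} {y} x≤y with x ≤? y
... | yes _   = refl
... | no  x≰y = contradiction x≤y x≰y

minF-≰ : ∀ {n} {x y : Fin n} → ¬ x ≤ y → minF x y ≡ y
minF-≰ {x = x} {y} x≰y with x ≤? y
... | yes x≤y = contradiction x≤y x≰y
... | no  _   = refl

maxF-≤ : ∀ {n} {x y : Fin n} → x ≤ y → maxF x y ≡ y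
maxF-≤ {x = x} {y} x≤y with x ≤? y
... | yes _   = refl
... | no  x≰y = contradiction x≤y x≰y

maxF-≰ : ∀ {n} {x y : Fin n} → ¬ x ≤ y → maxF x y ≡ x
maxF-≰ {x = x} {y} x≰y with x ≤? y
... | yes x≤y = contradiction x≤y x≰y
... | no  _   = refl

suc-≰ : ∀ {n} {x y : Fin n} → ¬ x ≤ y → ¬ suc x ≤ suc y
suc-≰ x≰y (s≤s x≤y) = x≰y x≤y

suc-minF : ∀ {n} (x y : Fin n) → minF (suc x) (suc y) ≡ suc (minF x y)
suc-minF x y with x ≤? y
... | yes x≤y = minF-≤ (s≤s x≤y)
... | no  x≰y = minF-≰ (suc-≰ x≰y)

suc-maxF : ∀ {n} (x y : Fin n) → maxF (suc x) (suc y) ≡ suc (maxF x y)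
suc-maxF x y with x ≤? y
... | yes x≤y = maxF-≤ (s≤s x≤y)
... | no  x≰y = maxF-≰ (suc-≰ x≰y)

nonzero-is-suc : ∀ {n} (z : Fin (suc n)) → ¬ z ≡ zero → Σ (Fin n) (λ w → suc w ≡ z)
nonzero-is-suc zero    z≢0 = contradiction refl z≢0
nonzero-is-suc (suc w) _   = w , refl

⇒-⊥⇒∧-⊥ : ∀ {A : Set} {_∨_ _∧_ _⇒_ : A → A → A} {⊥ ⊤ : A}
  → IsSemiHeyting _∨_ _∧_ _⇒_ ⊥ ⊤
  → ∀ x y → (x ⇒ y) ≡ ⊥ → (x ∧ y) ≡ ⊥
⇒-⊥⇒∧-⊥ {_∧_ = _∧_} {_⇒_} {⊥} H x y x⇒y≡⊥ = begin
  x ∧ y         ≡⟨ sym (sh2 x y) ⟩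
  x ∧ (x ⇒ y)   ≡⟨ cong (x ∧_) x⇒y≡⊥ ⟩
  x ∧ ⊥         ≡⟨ ∧-comm x ⊥ ⟩
  ⊥ ∧ x         ≡⟨ ⊥-least x ⟩
  ⊥             ∎
  where open IsSemiHeyting H
        open ≡-Reasoning

module _ {A B : Set}
  {_∨_ _∧_ _⇒_ : A → A → A} {⊥ ⊤ : A} (H : IsSemiHeyting _∨_ _∧_ _⇒_ ⊥ ⊤)
  {_∨'_ _∧'_ _⇒'_ : B → B → B} {⊥' ⊤' : B}
  (f : B → A) (f-injective : Injective _≡_ _≡_ f)
  (f-∨ : ∀ x y → f (x ∨' y) ≡ (f x ∨ f y))
  (f-∧ : ∀ x y → f (x ∧' y) ≡ (f x ∧ f y))
  (f-⇒ : ∀ x y → f (x ⇒' y) ≡ (f x ⇒ f y))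
  (f-⊤ : f ⊤' ≡ ⊤)
  (f-⊥-least : ∀ x → (f ⊥' ∧ f x) ≡ f ⊥')
  where
  open IsSemiHeyting H

  pullbackSemiHeyting : IsSemiHeyting _∨'_ _∧'_ _⇒'_ ⊥' ⊤'
  pullbackSemiHeyting = record
    { ∨-comm      = λ x y → f-injective (begin
        f (x ∨' y)   ≡⟨ f-∨ x y ⟩
        f x ∨ f y    ≡⟨ ∨-comm (f x) (f y) ⟩
        f y ∨ f x    ≡⟨ sym (f-∨ y x) ⟩
        f (y ∨' x)   ∎)
    ; ∧-comm      = λ x y → f-injective (begin
        f (x ∧' y)   ≡⟨ f-∧ x y ⟩
        f x ∧ f y    ≡⟨ ∧-comm (f x) (f y) ⟩
        f y ∧ f x    ≡⟨ sym (f-∧ y x) ⟩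
        f (y ∧' x)   ∎)
    ; ∨-assoc     = λ x y z → f-injective (begin
        f ((x ∨' y) ∨' z)        ≡⟨ trans (f-∨ _ z) (cong (_∨ f z) (f-∨ x y)) ⟩
        (f x ∨ f y) ∨ f z        ≡⟨ ∨-assoc (f x) (f y) (f z) ⟩
        f x ∨ (f y ∨ f z)        ≡⟨ sym (trans (f-∨ x _) (cong (f x ∨_) (f-∨ y z))) ⟩
        f (x ∨' (y ∨' z))        ∎)
    ; ∧-assoc     = λ x y z → f-injective (begin
        f ((x ∧' y) ∧' z)        ≡⟨ trans (f-∧ _ z) (cong (_∧ f z) (f-∧ x y)) ⟩
        (f x ∧ f y) ∧ f z        ≡⟨ ∧-assoc (f x) (f y) (f z) ⟩
        f x ∧ (f y ∧ f z)        ≡⟨ sym (trans (f-∧ x _) (cong (f x ∧_) (f-∧ y z))) ⟩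
        f (x ∧' (y ∧' z))        ∎)
    ; ∨-absorbs-∧ = λ x y → f-injective (begin
        f (x ∨' (x ∧' y))        ≡⟨ trans (f-∨ x _) (cong (f x ∨_) (f-∧ x y)) ⟩
        f x ∨ (f x ∧ f y)        ≡⟨ ∨-absorbs-∧ (f x) (f y) ⟩
        f x                      ∎)
    ; ∧-absorbs-∨ = λ x y → f-injective (begin
        f (x ∧' (x ∨' y))        ≡⟨ trans (f-∧ x _) (cong (f x ∧_) (f-∨ x y)) ⟩
        f x ∧ (f x ∨ f y)        ≡⟨ ∧-absorbs-∨ (f x) (f y) ⟩
        f x                      ∎)
    ; ⊥-least     = λ x → f-injective (trans (f-∧ ⊥' x) (f-⊥-least x))
    ; ⊤-greatest  = λ x → f-injective (begin
        f (x ∧' ⊤')              ≡⟨ trans (f-∧ x ⊤') (cong (f x ∧_) f-⊤) ⟩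
        f x ∧ ⊤                  ≡⟨ ⊤-greatest (f x) ⟩
        f x                      ∎)
    ; sh2         = λ x y → f-injective (begin
        f (x ∧' (x ⇒' y))        ≡⟨ trans (f-∧ x _) (cong (f x ∧_) (f-⇒ x y)) ⟩
        f x ∧ (f x ⇒ f y)        ≡⟨ sh2 (f x) (f y) ⟩
        f x ∧ f y                ≡⟨ sym (f-∧ x y) ⟩
        f (x ∧' y)               ∎)
    ; sh3         = λ x y z → f-injective (begin
        f (x ∧' (y ⇒' z))                  ≡⟨ trans (f-∧ x _) (cong (f x ∧_) (f-⇒ y z)) ⟩
        f x ∧ (f y ⇒ f z)                  ≡⟨ sh3 (f x) (f y) (f z) ⟩
        f x ∧ ((f x ∧ f y) ⇒ (f x ∧ f z))  ≡⟨ sym (cong (f x ∧_) f-⇒-∧) ⟩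
        f x ∧ f ((x ∧' y) ⇒' (x ∧' z))     ≡⟨ sym (f-∧ x _) ⟩
        f (x ∧' ((x ∧' y) ⇒' (x ∧' z)))    ∎)
    ; sh4         = λ x → f-injective (trans (f-⇒ x x) (trans (sh4 (f x)) (sym f-⊤)))
    }
    where
    open ≡-Reasoning
    f-⇒-∧ : ∀ {x y z} → f ((x ∧' y) ⇒' (x ∧' z)) ≡ ((f x ∧ f y) ⇒ (f x ∧ f z))
    f-⇒-∧ {x} {y} {z} = trans (f-⇒ _ _) (cong₂ _⇒_ (f-∧ x y) (f-∧ x z))

mainTheorem1 : (m : ℕ) → (_⇒_ : Fin (suc (suc m)) → Fin (suc (suc m)) → Fin (suc (suc m)))
    → IsSemiHeyting maxF minF _⇒_ zero (topF (suc m))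
    → ((x y : Fin (suc (suc m))) → ¬ x ≡ zero → ¬ y ≡ zero → ¬ (x ⇒ y) ≡ zero)
    × Σ (Fin (suc m) → Fin (suc m) → Fin (suc m))
    (λ _⇒'_ → ((x y : Fin (suc m)) → suc (x ⇒' y) ≡ (suc x ⇒ suc y))
    × IsSemiHeyting maxF minF _⇒'_ zero (topF m))
mainTheorem1 m _⇒_ H = closed , _⇒'_ , suc-⇒' , restricted
  where
  closed : (x y : Fin (suc (suc m))) → ¬ x ≡ zero → ¬ y ≡ zero → ¬ (x ⇒ y) ≡ zero
  closed x y x≢0 y≢0 x⇒y≡0 with minF-selective x y
  ... | inj₁ min≡x = x≢0 (trans (sym min≡x) (⇒-⊥⇒∧-⊥ H x y x⇒y≡0))
  ... | inj₂ min≡y = y≢0 (trans (sym min≡y) (⇒-⊥⇒∧-⊥ H x y x⇒y≡0))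

  restriction : (x y : Fin (suc m)) → Σ (Fin (suc m)) (λ w → suc w ≡ (suc x ⇒ suc y))
  restriction x y = nonzero-is-suc (suc x ⇒ suc y) (closed (suc x) (suc y) (λ ()) (λ ()))

  _⇒'_ : Fin (suc m) → Fin (suc m) → Fin (suc m)
  x ⇒' y = proj₁ (restriction x y)

  suc-⇒' : (x y : Fin (suc m)) → suc (x ⇒' y) ≡ (suc x ⇒ suc y)
  suc-⇒' x y = proj₂ (restriction x y)

  -- The new bottom a₁ = suc zero lies below every suc x.
  restricted : IsSemiHeyting maxF minF _⇒'_ zero (topF m)
  restricted = pullbackSemiHeyting H (suc {suc m}) suc-injective
    (λ x y → sym (suc-maxF x y)) (λ x y → sym (suc-minF x y)) suc-⇒' refl
    (λ x → minF-≤ {x = suc zero} {y = suc x} (s≤s z≤n))
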